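{- Let $v\in I(d)$ and let $w\in I(d,2d)$ with $w\ge v$. Then $w\in I(d)$ if and only if the distinguished subset $S_w$ of $N_v$ corresponding to $w$ is symmetric (i.e. $S_w^\#=S_w$) and contains an even number of elements of the diagonal $D_v$.
   Context: $k^*:=2d+1-k$. $I(d,2d)$: $d$-element subsets of $\{1,\dots,2d\}$ written increasingly, ordered by $u\le w$ iff $u_i\le w_i$ for all $i$. $I(d)\subseteq I(d,2d)$: those $u$ containing exactly one of $k,k^*$ for each $k$ and having an even number of entries exceeding $d$. $R_v=\{(r,c):r\notin v,\ c\in v\}$, $N_v=\{(r,c)\in R_v:r>c\}$, $D_v=\{(r,c)\in R_v:r=c^*\}$. For $\alpha=(r,c)\in R_v$, $\alpha^\#=(c^*,r^*)$, and $S^\#=\{\alpha^\#:\alpha\in S\}$. A subset $S\subseteq N_v$ is distinguished if for any two distinct elements $(R,C),(r,c)$ of $S$: (A) $R\neq r$ and $C\neq c$; (B) if $R>r$ then $r<C$ or $C<c$. To a distinguished subset $S$ associate the element of $I(d,2d)$ obtained from $v$ by removing all column indices of elements of $S$ and adding all row indices of elements of $S$; this gives a bijection from distinguished subsets of $N_v$ onto $\{w\in I(d,2d):w\ge v\}$, and $S_w$ denotes the distinguished subset corresponding to $w$. -}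

module Defs where

open import Data.Nat using (ℕ; _+_; _*_; _∸_; _≤_; _<_; _<?_; _≟_)
open import Data.Nat.Divisibility using (_∣_)
open import Data.Product using (_×_; _,_)
open import Data.Sum using (_⊎_)
open import Data.List using (List; length; filter; map)
open import Data.List.Membership.Propositional using (_∈_; _∉_)
open import Data.List.Relation.Unary.All using (All)
open import Data.List.Relation.Unary.Linked using (Linked)
open import Data.List.Relation.Unary.Unique.Propositional using (Unique)
open import Data.List.Relation.Binary.Pointwise using (Pointwise)
open import Relation.Binary.PropositionalEquality using (_≡_; _≢_)
open import Relation.Nullary using (¬_)
open import Function.Bundles using (_⇔_)

star : ℕ → ℕ → ℕ
star d k = (2 * d + 1) ∸ k

InRange : ℕ → ℕ → Set
InRange d k = 1 ≤ k × k ≤ 2 * d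

IsI2d : ℕ → List ℕ → Set
IsI2d d u = Linked _<_ u × length u ≡ d × All (InRange d) u

_≼_ : List ℕ → List ℕ → Set
u ≼ w = Pointwise _≤_ u w

ExactlyOne : ℕ → List ℕ → ℕ → Set
ExactlyOne d u k = (k ∈ u × star d k ∉ u) ⊎ (k ∉ u × star d k ∈ u)

numAbove : ℕ → List ℕ → ℕ
numAbove d u = length (filter (d <?_) u)

IsId : ℕ → List ℕ → Set
IsId d u = IsI2d d u
         × (∀ k → InRange d k → ExactlyOne d u k)
         × 2 ∣ numAbove d u

Pair : Set
Pair = ℕ × ℕ

InR : ℕ → List ℕ → Pair → Set
InR d v (r , c) = InRange d r × InRange d c × r ∉ v × c ∈ v

InN : ℕ → List ℕ → Pair → Set
InN d v (r , c) = InR d v (r , c) × c < r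

InD : ℕ → List ℕ → Pair → Set
InD d v (r , c) = InR d v (r , c) × r ≡ star d c

sharp : ℕ → Pair → Pair
sharp d (r , c) = (star d c , star d r)

sharpSet : ℕ → List Pair → List Pair
sharpSet d S = map (sharp d) S

CondAB : Pair → Pair → Set
CondAB (R , C) (r , c) = (R ≢ r × C ≢ c) × (r < R → (r < C ⊎ C < c))

-- S (a finite set, represented as a duplicate-free list) is a distinguished subset of N_v
Distinguished : ℕ → List ℕ → List Pair → Set
Distinguished d v S =
  Unique S
  × All (InN d v) S
  × (∀ α β → α ∈ S → β ∈ S → α ≢ β → CondAB α β)

Corresponds : List ℕ → List Pair → List ℕ → Set
Corresponds v S w =
  ∀ x → x ∈ w ⇔ ((x ∈ v × ¬ (x ∈ map Data.Product.proj₂ S)) ⊎ x ∈ map Data.Product.proj₁ S)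

SymmetricSet : ℕ → List Pair → Set
SymmetricSet d S = ∀ α → α ∈ sharpSet d S ⇔ α ∈ S

-- number of elements of S lying on the diagonal D_v (S ⊆ R_v, so only r = c* matters)
numDiag : ℕ → List Pair → ℕ
numDiag d S = length (filter (λ α → Data.Product.proj₁ α ≟ star d (Data.Product.proj₂ α)) S)

-- If w ∈ I(d), the involution k ↦ k* maps cols S = v ∖ w onto rows S = w ∖ v and back, because both v
-- and w contain exactly one of k, k*. Hence S^# is a non-crossing matching with the same rows and columns
-- as S, and a non-crossing matching is determined by its rows and columns (induct on the length r − c of
-- an arc), so S^# = S. Conversely, when S^# = S the same exchange of rows and columns shows that w
-- contains exactly one of k, k*.
-- For the parity, count entries exceeding d on both sides of w ∪ cols S = v ∪ rows S, and use that #
-- maps the pairs of S with c > d onto those with r ≤ d, and those with c* < r onto those with r < c*: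
--   numAbove w + 2 #{c > d} = numAbove v + 2 #{c* < r} + #(S ∩ D_v).

module Submission where

open import Defs
open import Data.List using (List)
open import Data.Nat using (ℕ)
open import Data.Nat.Divisibility using (_∣_)
open import Data.Product using (_×_)
open import Function.Bundles using (_⇔_)

open import Data.Empty using (⊥; ⊥-elim)
open import Data.List using ([]; _∷_; _++_; filter; length; map)
open import Data.List.Membership.DecPropositional Data.Nat._≟_ using (_∈?_)
open import Data.List.Membership.Propositional using (_∈_; _∉_)
open import Data.List.Membership.Propositional.Properties
  using (∈-map⁺; ∈-map⁻; ∈-++⁺ˡ; ∈-++⁺ʳ; ∈-++⁻)
open import Data.List.Membership.Propositional.Properties.WithK using (unique∧set⇒bag)
open import Data.List.Properties using (map-++; map-∘; map-cong-local)
open import Data.List.Relation.Binary.BagAndSetEquality using (_∼[_]_; set; ∼bag⇒↭)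
open import Data.List.Relation.Binary.Permutation.Propositional using (_↭_)
import Data.List.Relation.Binary.Permutation.Propositional.Properties as ↭
open import Data.List.Relation.Binary.Subset.Propositional using (_⊆_)
import Data.List.Relation.Unary.All as All
import Data.List.Relation.Unary.All.Properties as All
import Data.List.Relation.Unary.AllPairs as AllPairs
open import Data.List.Relation.Unary.Any using (here; there)
open import Data.List.Relation.Unary.Linked using (Linked)
open import Data.List.Relation.Unary.Linked.Properties using (Linked⇒AllPairs)
open import Data.List.Relation.Unary.Unique.Propositional using (Unique; []; _∷_)
open import Data.List.Relation.Unary.Unique.Propositional.Properties using (++⁺)
open import Data.Nat using (s≤s; suc; zero; _+_; _*_; _∸_; _≤_; _<_; _<?_; _≟_)
open import Data.Nat.Divisibility using (divides; ∣m+n∣m⇒∣n; ∣m∣n⇒∣m+n)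
open import Data.Nat.ListAction using (sum)
open import Data.Nat.ListAction.Properties using (sum-++; sum-↭)
open import Data.Nat.Properties
open import Algebra.Properties.CommutativeSemigroup +-commutativeSemigroup using (interchange)
open import Data.Product using (_,_; proj₁; proj₂; ∃; ∃₂)
open import Data.Sum using (inj₁; inj₂)
open import Function.Base using (_∘_)
open import Function.Bundles using (mk⇔; Equivalence)
open import Relation.Binary.Definitions using (tri<; tri≈; tri>)
open import Relation.Binary.PropositionalEquality
open import Relation.Nullary using (Dec; yes; no)
open import Relation.Unary using (Pred; Decidable)

private variable
  A B : Set

indicator : ∀ {p} {P : Set p} → Dec P → ℕ
indicator (yes _) = 1
indicator (no _)  = 0

∑ : List A → (A → ℕ) → ℕ
∑ xs f = sum (map f xs)

∑-++ : ∀ (xs ys : List A) f → ∑ (xs ++ ys) f ≡ ∑ xs f + ∑ ys f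
∑-++ xs ys f = trans (cong sum (map-++ f xs ys)) (sum-++ (map f xs) (map f ys))

∑-map : ∀ (g : A → B) xs f → ∑ (map g xs) f ≡ ∑ xs (f ∘ g)
∑-map g xs f = cong sum (sym (map-∘ xs))

∑-↭ : ∀ {xs ys : List A} f → xs ↭ ys → ∑ xs f ≡ ∑ ys f
∑-↭ f xs↭ys = sum-↭ (↭.map⁺ f xs↭ys)

∑-+ : ∀ (xs : List A) f g → ∑ xs (λ x → f x + g x) ≡ ∑ xs f + ∑ xs g
∑-+ []       f g = refl
∑-+ (x ∷ xs) f g = trans (cong (f x + g x +_) (∑-+ xs f g)) (interchange (f x) (g x) _ _)

∑-cong : ∀ {xs : List A} {f g} → (∀ {x} → x ∈ xs → f x ≡ g x) → ∑ xs f ≡ ∑ xs g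
∑-cong f≡g = cong sum (map-cong-local (All.tabulate f≡g))

length-filter≡∑ : ∀ {p} {P : Pred A p} (P? : Decidable P) xs →
                  length (filter P? xs) ≡ ∑ xs (indicator ∘ P?)
length-filter≡∑ P? []       = refl
length-filter≡∑ P? (x ∷ xs) with P? x
... | yes _ = cong suc (length-filter≡∑ P? xs)
... | no  _ = length-filter≡∑ P? xs

<-trichotomy-indicator : ∀ m n → indicator (m <? n) + indicator (n <? m) + indicator (n ≟ m) ≡ 1
<-trichotomy-indicator m n with m <? n | n <? m | n ≟ m
... | yes m<n | yes n<m | _        = ⊥-elim (<-asym m<n n<m)
... | yes m<n | no  _   | yes refl = ⊥-elim (<-irrefl refl m<n)
... | yes _   | no  _   | no  _    = refl
... | no  _   | yes n<m | yes refl = ⊥-elim (<-irrefl refl n<m)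
... | no  _   | yes _   | no  _    = refl
... | no  _   | no  _   | yes _    = refl
... | no  m≮n | no  n≮m | no  n≢m  = ⊥-elim (n≢m (≤-antisym (≮⇒≥ m≮n) (≮⇒≥ n≮m)))

unique-map-injectiveOn : ∀ {f : A → B} {xs} → (∀ {x y} → x ∈ xs → y ∈ xs → f x ≡ f y → x ≡ y) →
                         Unique xs → Unique (map f xs)
unique-map-injectiveOn inj []            = []
unique-map-injectiveOn inj (x≢xs ∷ xs!) =
  All.map⁺ (All.tabulate λ y∈xs fx≡fy → All.lookup x≢xs y∈xs (inj (here refl) (there y∈xs) fx≡fy))
  ∷ unique-map-injectiveOn (λ x∈ y∈ → inj (there x∈) (there y∈)) xs!

strictlyIncreasing⇒unique : ∀ {xs} → Linked _<_ xs → Unique xs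
strictlyIncreasing⇒unique = AllPairs.map <⇒≢ ∘ Linked⇒AllPairs <-trans

unique∧set⇒↭ : ∀ {xs ys : List A} → Unique xs → Unique ys → xs ∼[ set ] ys → xs ↭ ys
unique∧set⇒↭ xs! ys! xs≈ys = ∼bag⇒↭ (unique∧set⇒bag xs! ys! xs≈ys)

parity-transfer : ∀ {a b x y z} → a + (x + x) ≡ b + (y + y) + z → 2 ∣ b → 2 ∣ a ⇔ 2 ∣ z
parity-transfer {a} {b} {x} {y} {z} eq 2∣b = mk⇔
  (λ 2∣a → ∣m+n∣m⇒∣n (subst (2 ∣_) eq (∣m∣n⇒∣m+n 2∣a (2∣n+n x))) (∣m∣n⇒∣m+n 2∣b (2∣n+n y)))
  (λ 2∣z → ∣m+n∣m⇒∣n (subst (2 ∣_) (trans (sym eq) (+-comm a _)) (∣m∣n⇒∣m+n (∣m∣n⇒∣m+n 2∣b (2∣n+n y)) 2∣z))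
                     (2∣n+n x))
  where
  2∣n+n : ∀ n → 2 ∣ n + n
  2∣n+n n = divides n (trans (cong (n +_) (sym (+-identityʳ n))) (*-comm 2 n))

module _ (d : ℕ) where

  private
    2d+1≡d+[1+d] : 2 * d + 1 ≡ d + suc d
    2d+1≡d+[1+d] = trans (cong (λ n → d + n + 1) (+-identityʳ d))
                         (trans (+-assoc d d 1) (cong (d +_) (+-comm d 1)))

  star-involutive : ∀ {k} → InRange d k → star d (star d k) ≡ k
  star-involutive (_ , k≤2d) = m∸[m∸n]≡n (≤-trans k≤2d (m≤m+n _ 1))

  star-inRange : ∀ {k} → InRange d k → InRange d (star d k)
  star-inRange {k} (1≤k , k≤2d) =
    m<n⇒0<n∸m (subst (k <_) (+-comm 1 (2 * d)) (s≤s k≤2d)) ,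
    ≤-trans (∸-monoʳ-≤ (2 * d + 1) 1≤k) (≤-reflexive (m+n∸n≡m (2 * d) 1))

  star-reverses-< : ∀ {a b} → InRange d b → a < b → star d b < star d a
  star-reverses-< (_ , b≤2d) a<b = ∸-monoʳ-< a<b (≤-trans b≤2d (m≤m+n _ 1))

  star-reflects-< : ∀ {a b} → InRange d a → InRange d b → star d a < star d b → b < a
  star-reflects-< ra rb a*<b* =
    subst₂ _<_ (star-involutive rb) (star-involutive ra) (star-reverses-< (star-inRange rb) a*<b*)

  star-injective : ∀ {a b} → InRange d a → InRange d b → star d a ≡ star d b → a ≡ b
  star-injective ra rb a*≡b* =
    trans (sym (star-involutive ra)) (trans (cong (star d) a*≡b*) (star-involutive rb))

  ≤⇒<star : ∀ {k} → k ≤ d → d < star d k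
  ≤⇒<star k≤d = ≤-trans (≤-reflexive (sym (trans (cong (_∸ d) 2d+1≡d+[1+d]) (m+n∸m≡n d (suc d)))))
                        (∸-monoʳ-≤ (2 * d + 1) k≤d)

  >⇒star≤ : ∀ {k} → d < k → star d k ≤ d
  >⇒star≤ d<k = ≤-trans (∸-monoʳ-≤ (2 * d + 1) d<k)
    (≤-reflexive (trans (cong (_∸ suc d) (trans 2d+1≡d+[1+d] (+-comm d (suc d)))) (m+n∸m≡n (suc d) d)))

  above-or-star-above : ∀ k → indicator (d <? k) + indicator (d <? star d k) ≡ 1
  above-or-star-above k with d <? k | d <? star d k
  ... | yes d<k | yes d<k* = ⊥-elim (<⇒≱ d<k* (>⇒star≤ d<k))
  ... | yes _   | no  _    = refl
  ... | no  _   | yes _    = refl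
  ... | no  d≮k | no  d≮k* = ⊥-elim (d≮k* (≤⇒<star (≮⇒≥ d≮k)))

  sharp-injective : ∀ {r c r′ c′} → InRange d r × InRange d c → InRange d r′ × InRange d c′ →
                    sharp d (r , c) ≡ sharp d (r′ , c′) → (r , c) ≡ (r′ , c′)
  sharp-injective (rr , rc) (rr′ , rc′) eq =
    cong₂ _,_ (star-injective rr rr′ (cong proj₂ eq)) (star-injective rc rc′ (cong proj₁ eq))

OneOfEachPair : ℕ → List ℕ → Set
OneOfEachPair d u = ∀ k → InRange d k → ExactlyOne d u k

module _ (d : ℕ) {u : List ℕ} where

  ∈⇒star∉ : OneOfEachPair d u → ∀ {k} → InRange d k → k ∈ u → star d k ∉ u
  ∈⇒star∉ one {k} rk k∈u with one k rk
  ... | inj₁ (_ , k*∉u) = k*∉u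
  ... | inj₂ (k∉u , _)  = ⊥-elim (k∉u k∈u)

  ∉⇒star∈ : OneOfEachPair d u → ∀ {k} → InRange d k → k ∉ u → star d k ∈ u
  ∉⇒star∈ one {k} rk k∉u with one k rk
  ... | inj₁ (k∈u , _)  = ⊥-elim (k∉u k∈u)
  ... | inj₂ (_ , k*∈u) = k*∈u

  ExactlyOne-star : ∀ {k} → InRange d k → ExactlyOne d u (star d k) → ExactlyOne d u k
  ExactlyOne-star rk (inj₁ (k*∈u , k**∉u)) = inj₂ (subst (_∉ u) (star-involutive d rk) k**∉u , k*∈u)
  ExactlyOne-star rk (inj₂ (k*∉u , k**∈u)) = inj₁ (subst (_∈ u) (star-involutive d rk) k**∈u , k*∉u)

star-swaps-differences : ∀ d {u u′ k} → OneOfEachPair d u → OneOfEachPair d u′ → InRange d k →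
                         k ∈ u × k ∉ u′ → star d k ∈ u′ × star d k ∉ u
star-swaps-differences d one one′ rk (k∈u , k∉u′) = ∉⇒star∈ d one′ rk k∉u′ , ∈⇒star∉ d one rk k∈u

rows cols : List Pair → List ℕ
rows = map proj₁
cols = map proj₂

-- A pair (r , c) is read as an arc from c up to r; two arcs (r , c) and (R , C) cross when c < C < r < R.
record NonCrossingMatching (A : List Pair) : Set where
  field
    col<row      : ∀ {r c} → (r , c) ∈ A → c < r
    row-unique   : ∀ {r c c′} → (r , c) ∈ A → (r , c′) ∈ A → c ≡ c′
    col-unique   : ∀ {r r′ c} → (r , c) ∈ A → (r′ , c) ∈ A → r ≡ r′
    non-crossing : ∀ {r c R C} → (r , c) ∈ A → (R , C) ∈ A → c < C → C < r → r < R → ⊥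

∈rows⇒arc : ∀ {A r} → r ∈ rows A → ∃ λ c → (r , c) ∈ A
∈rows⇒arc r∈ with ∈-map⁻ proj₁ r∈
... | (_ , c) , rc∈A , refl = c , rc∈A

∈cols⇒arc : ∀ {A c} → c ∈ cols A → ∃ λ r → (r , c) ∈ A
∈cols⇒arc c∈ with ∈-map⁻ proj₂ c∈
... | (r , _) , rc∈A , refl = r , rc∈A

module _ {A : List Pair} (nc : NonCrossingMatching A) (A! : Unique A) where
  open NonCrossingMatching nc

  rows-unique : Unique (rows A)
  rows-unique = unique-map-injectiveOn same-row A!
    where
    same-row : ∀ {α β} → α ∈ A → β ∈ A → proj₁ α ≡ proj₁ β → α ≡ β
    same-row {r , _} α∈A β∈A refl = cong (r ,_) (row-unique α∈A β∈A)

  cols-unique : Unique (cols A)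
  cols-unique = unique-map-injectiveOn same-col A!
    where
    same-col : ∀ {α β} → α ∈ A → β ∈ A → proj₂ α ≡ proj₂ β → α ≡ β
    same-col {_ , c} α∈A β∈A refl = cong (_, c) (col-unique α∈A β∈A)

module _ {A B : List Pair} (ncA : NonCrossingMatching A) (ncB : NonCrossingMatching B) where
  private
    module A = NonCrossingMatching ncA
    module B = NonCrossingMatching ncB

  -- A mismatch yields a shorter arc violating uniqueness in A, or two crossing arcs in B.
  arc-transfer : ∀ n → rows A ⊆ rows B → cols A ⊆ cols B →
                 (∀ {r c} → r ≤ c + n → (r , c) ∈ B → (r , c) ∈ A) →
                 ∀ {r c} → r ≤ c + suc n → (r , c) ∈ A → (r , c) ∈ B
  arc-transfer n rows⊆ cols⊆ shorter {r} {c} r≤c+1+n rc∈A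
    with ∈cols⇒arc (cols⊆ (∈-map⁺ proj₂ rc∈A))
  ... | r′ , r′c∈B with <-cmp r′ r
  ... | tri≈ _ refl _ = r′c∈B
  ... | tri< r′<r _ _ =
    ⊥-elim (<-irrefl (A.col-unique (shorter r′≤c+n r′c∈B) rc∈A) r′<r)
    where
    r′≤c+n : r′ ≤ c + n
    r′≤c+n = ≤-pred (subst (r′ <_) (+-suc c n) (<-≤-trans r′<r r≤c+1+n))
  ... | tri> _ _ r<r′ with ∈rows⇒arc (rows⊆ (∈-map⁺ proj₁ rc∈A))
  ...   | c′ , rc′∈B with <-cmp c′ c
  ...     | tri≈ _ refl _ = rc′∈B
  ...     | tri< c′<c _ _ = ⊥-elim (B.non-crossing rc′∈B r′c∈B c′<c (A.col<row rc∈A) r<r′)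
  ...     | tri> _ _ c<c′ =
    ⊥-elim (<-irrefl (A.row-unique rc∈A (shorter r≤c′+n rc′∈B)) c<c′)
    where
    r≤c′+n : r ≤ c′ + n
    r≤c′+n = ≤-trans r≤c+1+n (≤-trans (≤-reflexive (+-suc c n)) (+-monoˡ-≤ n c<c′))

nonCrossing-determinedBy-rows∧cols : ∀ {A B} → NonCrossingMatching A → NonCrossingMatching B →
  rows A ∼[ set ] rows B → cols A ∼[ set ] cols B → A ∼[ set ] B
nonCrossing-determinedBy-rows∧cols {A} {B} ncA ncB rows≈ cols≈ {r , c} = agree r (m≤n+m r c)
  where
  open Equivalence using (to; from)
  agree : ∀ n {r c} → r ≤ c + n → (r , c) ∈ A ⇔ (r , c) ∈ B
  agree zero {r} {c} r≤c+0 = mk⇔ (⊥-elim ∘ below ncA) (⊥-elim ∘ below ncB)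
    where
    below : ∀ {X} → NonCrossingMatching X → (r , c) ∈ X → ⊥
    below ncX rc∈X = <⇒≱ (NonCrossingMatching.col<row ncX rc∈X) (subst (r ≤_) (+-identityʳ c) r≤c+0)
  agree (suc n) r≤c+1+n = mk⇔
    (arc-transfer ncA ncB n (to rows≈) (to cols≈) (λ le → from (agree n le)) r≤c+1+n)
    (arc-transfer ncB ncA n (from rows≈) (from cols≈) (λ le → to (agree n le)) r≤c+1+n)

StarSwapsRowsCols : ℕ → List Pair → Set
StarSwapsRowsCols d A =
  (∀ {c} → c ∈ cols A → star d c ∈ rows A) × (∀ {r} → r ∈ rows A → star d r ∈ cols A)

∈-sharpSet⁻ : ∀ d {A x y} → (x , y) ∈ sharpSet d A → ∃₂ λ r c → (r , c) ∈ A × x ≡ star d c × y ≡ star d r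
∈-sharpSet⁻ d α∈ with ∈-map⁻ (sharp d) α∈
... | (r , c) , rc∈A , refl = r , c , rc∈A , refl , refl

rows-sharpSet : ∀ d A → rows (sharpSet d A) ≡ map (star d) (cols A)
rows-sharpSet d A = trans (sym (map-∘ A)) (map-∘ A)

cols-sharpSet : ∀ d A → cols (sharpSet d A) ≡ map (star d) (rows A)
cols-sharpSet d A = trans (sym (map-∘ A)) (map-∘ A)

map-star-∼ : ∀ d {xs ys} → (∀ {y} → y ∈ ys → InRange d y) →
             (∀ {x} → x ∈ xs → star d x ∈ ys) → (∀ {y} → y ∈ ys → star d y ∈ xs) →
             map (star d) xs ∼[ set ] ys
map-star-∼ d {xs} {ys} inRange xs→ys ys→xs = mk⇔ to from
  where
  to : ∀ {y} → y ∈ map (star d) xs → y ∈ ys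
  to y∈ with ∈-map⁻ (star d) y∈
  ... | _ , x∈xs , refl = xs→ys x∈xs
  from : ∀ {y} → y ∈ ys → y ∈ map (star d) xs
  from y∈ys = subst (_∈ map (star d) xs) (star-involutive d (inRange y∈ys)) (∈-map⁺ (star d) (ys→xs y∈ys))

symmetric⇒starSwaps : ∀ d {A} → SymmetricSet d A → StarSwapsRowsCols d A
symmetric⇒starSwaps d {A} A#≈A = star-col∈rows , star-row∈cols
  where
  sharp∈ : ∀ {α} → α ∈ A → sharp d α ∈ A
  sharp∈ α∈A = Equivalence.to (A#≈A _) (∈-map⁺ (sharp d) α∈A)
  star-col∈rows : ∀ {c} → c ∈ cols A → star d c ∈ rows A
  star-col∈rows c∈ = ∈-map⁺ proj₁ (sharp∈ (proj₂ (∈cols⇒arc c∈)))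
  star-row∈cols : ∀ {r} → r ∈ rows A → star d r ∈ cols A
  star-row∈cols r∈ = ∈-map⁺ proj₂ (sharp∈ (proj₂ (∈rows⇒arc r∈)))

module _ (d : ℕ) {A : List Pair} (inRange : ∀ {r c} → (r , c) ∈ A → InRange d r × InRange d c) where

  sharp-nonCrossing : NonCrossingMatching A → NonCrossingMatching (sharpSet d A)
  sharp-nonCrossing nc = record
    { col<row = col<row#
    ; row-unique = row-unique#
    ; col-unique = col-unique#
    ; non-crossing = non-crossing#
    }
    where
    open NonCrossingMatching nc
    col<row# : ∀ {x y} → (x , y) ∈ sharpSet d A → y < x
    col<row# α∈ with ∈-sharpSet⁻ d α∈
    ... | r , c , rc∈A , refl , refl = star-reverses-< d (proj₁ (inRange rc∈A)) (col<row rc∈A)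
    row-unique# : ∀ {x y y′} → (x , y) ∈ sharpSet d A → (x , y′) ∈ sharpSet d A → y ≡ y′
    row-unique# α∈ β∈ with ∈-sharpSet⁻ d α∈ | ∈-sharpSet⁻ d β∈
    ... | r , c , rc∈A , refl , refl | r′ , c′ , r′c′∈A , c*≡c′* , refl
      with star-injective d (proj₂ (inRange rc∈A)) (proj₂ (inRange r′c′∈A)) c*≡c′*
    ... | refl = cong (star d) (col-unique rc∈A r′c′∈A)
    col-unique# : ∀ {x x′ y} → (x , y) ∈ sharpSet d A → (x′ , y) ∈ sharpSet d A → x ≡ x′
    col-unique# α∈ β∈ with ∈-sharpSet⁻ d α∈ | ∈-sharpSet⁻ d β∈
    ... | r , c , rc∈A , refl , refl | r′ , c′ , r′c′∈A , refl , r*≡r′*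
      with star-injective d (proj₁ (inRange rc∈A)) (proj₁ (inRange r′c′∈A)) r*≡r′*
    ... | refl = cong (star d) (row-unique rc∈A r′c′∈A)
    non-crossing# : ∀ {x y X Y} → (x , y) ∈ sharpSet d A → (X , Y) ∈ sharpSet d A → y < Y → Y < x → x < X → ⊥
    non-crossing# α∈ β∈ y<Y Y<x x<X with ∈-sharpSet⁻ d α∈ | ∈-sharpSet⁻ d β∈
    ... | r , c , rc∈A , refl , refl | R , C , RC∈A , refl , refl =
      non-crossing RC∈A rc∈A (star-reflects-< d (proj₂ (inRange rc∈A)) (proj₂ (inRange RC∈A)) x<X)
                             (star-reflects-< d (proj₁ (inRange RC∈A)) (proj₂ (inRange rc∈A)) Y<x)
                             (star-reflects-< d (proj₁ (inRange rc∈A)) (proj₁ (inRange RC∈A)) y<Y)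

  starSwaps⇒symmetric : NonCrossingMatching A → StarSwapsRowsCols d A → SymmetricSet d A
  starSwaps⇒symmetric nc (star-col∈rows , star-row∈cols) _ =
    nonCrossing-determinedBy-rows∧cols (sharp-nonCrossing nc) nc rows≈ cols≈
    where
    rows-inRange : ∀ {r} → r ∈ rows A → InRange d r
    rows-inRange r∈ = proj₁ (inRange (proj₂ (∈rows⇒arc r∈)))
    cols-inRange : ∀ {c} → c ∈ cols A → InRange d c
    cols-inRange c∈ = proj₂ (inRange (proj₂ (∈cols⇒arc c∈)))
    rows≈ : rows (sharpSet d A) ∼[ set ] rows A
    rows≈ = subst (_∼[ set ] rows A) (sym (rows-sharpSet d A))
                  (map-star-∼ d rows-inRange star-col∈rows star-row∈cols)
    cols≈ : cols (sharpSet d A) ∼[ set ] cols A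
    cols≈ = subst (_∼[ set ] cols A) (sym (cols-sharpSet d A))
                  (map-star-∼ d cols-inRange star-row∈cols star-col∈rows)

module Correspondence {d : ℕ} {v w : List ℕ} {S : List Pair}
  (v∈Id : IsId d v) (w∈I2d : IsI2d d w) (dist : Distinguished d v S) (cor : Corresponds v S w) where

  private
    v-oneOfEachPair : OneOfEachPair d v
    v-oneOfEachPair = proj₁ (proj₂ v∈Id)

    S-unique : Unique S
    S-unique = proj₁ dist

    S⊆Nv : ∀ {α} → α ∈ S → InN d v α
    S⊆Nv = All.lookup (proj₁ (proj₂ dist))

    conditionAB : ∀ α β → α ∈ S → β ∈ S → α ≢ β → CondAB α β
    conditionAB = proj₂ (proj₂ dist)

  S-inRange : ∀ {r c} → (r , c) ∈ S → InRange d r × InRange d c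
  S-inRange rc∈S = proj₁ (proj₁ (S⊆Nv rc∈S)) , proj₁ (proj₂ (proj₁ (S⊆Nv rc∈S)))

  S-nonCrossing : NonCrossingMatching S
  S-nonCrossing = record
    { col<row = λ rc∈S → proj₂ (S⊆Nv rc∈S)
    ; row-unique = row-unique
    ; col-unique = col-unique
    ; non-crossing = non-crossing
    }
    where
    row-unique : ∀ {r c c′} → (r , c) ∈ S → (r , c′) ∈ S → c ≡ c′
    row-unique {c = c} {c′} rc∈S rc′∈S with c ≟ c′
    ... | yes c≡c′ = c≡c′
    ... | no  c≢c′ = ⊥-elim (proj₁ (proj₁ (conditionAB _ _ rc∈S rc′∈S (c≢c′ ∘ cong proj₂))) refl)
    col-unique : ∀ {r r′ c} → (r , c) ∈ S → (r′ , c) ∈ S → r ≡ r′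
    col-unique {r} {r′} rc∈S r′c∈S with r ≟ r′
    ... | yes r≡r′ = r≡r′
    ... | no  r≢r′ = ⊥-elim (proj₂ (proj₁ (conditionAB _ _ rc∈S r′c∈S (r≢r′ ∘ cong proj₁))) refl)
    non-crossing : ∀ {r c R C} → (r , c) ∈ S → (R , C) ∈ S → c < C → C < r → r < R → ⊥
    non-crossing rc∈S RC∈S c<C C<r r<R
      with proj₂ (conditionAB _ _ RC∈S rc∈S (λ eq → <-irrefl (cong proj₁ (sym eq)) r<R)) r<R
    ... | inj₁ r<C = <-asym r<C C<r
    ... | inj₂ C<c = <-asym C<c c<C

  private
    row∉v : ∀ {r} → r ∈ rows S → r ∉ v
    row∉v r∈ = proj₁ (proj₂ (proj₂ (proj₁ (S⊆Nv (proj₂ (∈rows⇒arc r∈))))))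

    col∈v : ∀ {c} → c ∈ cols S → c ∈ v
    col∈v c∈ = proj₂ (proj₂ (proj₂ (proj₁ (S⊆Nv (proj₂ (∈cols⇒arc c∈))))))

  rows⇔w∖v : ∀ {x} → x ∈ rows S ⇔ (x ∈ w × x ∉ v)
  rows⇔w∖v {x} = mk⇔ (λ x∈rows → Equivalence.from (cor x) (inj₂ x∈rows) , row∉v x∈rows) from
    where
    from : x ∈ w × x ∉ v → x ∈ rows S
    from (x∈w , x∉v) with Equivalence.to (cor x) x∈w
    ... | inj₁ (x∈v , _) = ⊥-elim (x∉v x∈v)
    ... | inj₂ x∈rows    = x∈rows

  cols⇔v∖w : ∀ {x} → x ∈ cols S ⇔ (x ∈ v × x ∉ w)
  cols⇔v∖w {x} = mk⇔ (λ x∈cols → col∈v x∈cols , x∉w x∈cols) from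
    where
    x∉w : x ∈ cols S → x ∉ w
    x∉w x∈cols x∈w with Equivalence.to (cor x) x∈w
    ... | inj₁ (_ , x∉cols) = x∉cols x∈cols
    ... | inj₂ x∈rows       = row∉v x∈rows (col∈v x∈cols)
    from : x ∈ v × x ∉ w → x ∈ cols S
    from (x∈v , x∉w) with x ∈? cols S
    ... | yes x∈cols = x∈cols
    ... | no  x∉cols = ⊥-elim (x∉w (Equivalence.from (cor x) (inj₁ (x∈v , x∉cols))))

  w-oneOfEachPair⇒starSwaps : OneOfEachPair d w → StarSwapsRowsCols d S
  w-oneOfEachPair⇒starSwaps w-oneOfEachPair =
      (λ c∈ → Equivalence.from rows⇔w∖v
                (star-swaps-differences d v-oneOfEachPair w-oneOfEachPair
                  (proj₂ (S-inRange (proj₂ (∈cols⇒arc c∈)))) (Equivalence.to cols⇔v∖w c∈)))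
    , (λ r∈ → Equivalence.from cols⇔v∖w
                (star-swaps-differences d w-oneOfEachPair v-oneOfEachPair
                  (proj₁ (S-inRange (proj₂ (∈rows⇒arc r∈)))) (Equivalence.to rows⇔w∖v r∈)))

  private
    exactlyOne-of-∈v : StarSwapsRowsCols d S → ∀ {k} → InRange d k → k ∈ v → ExactlyOne d w k
    exactlyOne-of-∈v (star-col∈rows , star-row∈cols) {k} rk k∈v with k ∈? cols S
    ... | yes k∈cols = inj₂ ( proj₂ (Equivalence.to cols⇔v∖w k∈cols)
                            , proj₁ (Equivalence.to rows⇔w∖v (star-col∈rows k∈cols)))
    ... | no  k∉cols = inj₁ (Equivalence.from (cor k) (inj₁ (k∈v , k∉cols)) , k*∉w)
      where
      k*∉w : star d k ∉ w
      k*∉w k*∈w = k∉cols (subst (_∈ cols S) (star-involutive d rk)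
                    (star-row∈cols (Equivalence.from rows⇔w∖v (k*∈w , ∈⇒star∉ d v-oneOfEachPair rk k∈v))))

  starSwaps⇒w-oneOfEachPair : StarSwapsRowsCols d S → OneOfEachPair d w
  starSwaps⇒w-oneOfEachPair swaps k rk with k ∈? v
  ... | yes k∈v = exactlyOne-of-∈v swaps rk k∈v
  ... | no  k∉v =
    ExactlyOne-star d rk (exactlyOne-of-∈v swaps (star-inRange d rk) (∉⇒star∈ d v-oneOfEachPair rk k∉v))

  private
    above : ℕ → ℕ
    above x = indicator (d <? x)

    numAbove≡∑ : ∀ u → numAbove d u ≡ ∑ u above
    numAbove≡∑ = length-filter≡∑ (d <?_)

    -- w = (v ∖ cols S) ∪ rows S, where cols S ⊆ v and rows S is disjoint from v.
    w++cols↭v++rows : w ++ cols S ↭ v ++ rows S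
    w++cols↭v++rows = unique∧set⇒↭
      (++⁺ (strictlyIncreasing⇒unique (proj₁ w∈I2d)) (cols-unique S-nonCrossing S-unique)
           (λ (x∈w , x∈cols) → proj₂ (Equivalence.to cols⇔v∖w x∈cols) x∈w))
      (++⁺ (strictlyIncreasing⇒unique (proj₁ (proj₁ v∈Id))) (rows-unique S-nonCrossing S-unique)
           (λ (x∈v , x∈rows) → proj₂ (Equivalence.to rows⇔w∖v x∈rows) x∈v))
      (mk⇔ to from)
      where
      to : ∀ {x} → x ∈ w ++ cols S → x ∈ v ++ rows S
      to {x} x∈ with ∈-++⁻ w x∈
      ... | inj₂ x∈cols = ∈-++⁺ˡ (proj₁ (Equivalence.to cols⇔v∖w x∈cols))
      ... | inj₁ x∈w with Equivalence.to (cor x) x∈w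
      ...   | inj₁ (x∈v , _) = ∈-++⁺ˡ x∈v
      ...   | inj₂ x∈rows    = ∈-++⁺ʳ v x∈rows
      from : ∀ {x} → x ∈ v ++ rows S → x ∈ w ++ cols S
      from {x} x∈ with ∈-++⁻ v x∈
      ... | inj₂ x∈rows = ∈-++⁺ˡ (proj₁ (Equivalence.to rows⇔w∖v x∈rows))
      ... | inj₁ x∈v with x ∈? w
      ...   | yes x∈w = ∈-++⁺ˡ x∈w
      ...   | no  x∉w = ∈-++⁺ʳ w (Equivalence.from cols⇔v∖w (x∈v , x∉w))

    numAbove-exchange : numAbove d w + ∑ S (above ∘ proj₂) ≡ numAbove d v + ∑ S (above ∘ proj₁)
    numAbove-exchange = begin
      numAbove d w + ∑ S (above ∘ proj₂)  ≡⟨ cong₂ _+_ (numAbove≡∑ w) (sym (∑-map proj₂ S above)) ⟩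
      ∑ w above + ∑ (cols S) above        ≡⟨ sym (∑-++ w (cols S) above) ⟩
      ∑ (w ++ cols S) above               ≡⟨ ∑-↭ above w++cols↭v++rows ⟩
      ∑ (v ++ rows S) above               ≡⟨ ∑-++ v (rows S) above ⟩
      ∑ v above + ∑ (rows S) above        ≡⟨ cong₂ _+_ (sym (numAbove≡∑ v)) (∑-map proj₁ S above) ⟩
      numAbove d v + ∑ S (above ∘ proj₁)  ∎
      where open ≡-Reasoning

  module _ (S-symmetric : SymmetricSet d S) where

    private
      ∑-sharp : ∀ f → ∑ S (f ∘ sharp d) ≡ ∑ S f
      ∑-sharp f = trans (sym (∑-map (sharp d) S f)) (∑-↭ f sharpS↭S)
        where
        sharpS↭S : sharpSet d S ↭ S
        sharpS↭S = unique∧set⇒↭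
          (unique-map-injectiveOn (λ α∈ β∈ → sharp-injective d (S-inRange α∈) (S-inRange β∈)) S-unique)
          S-unique (λ {α} → S-symmetric α)

      pastDiagonal onDiagonal : Pair → ℕ
      pastDiagonal (r , c) = indicator (star d c <? r)
      onDiagonal   (r , c) = indicator (r ≟ star d c)

      rows-above+cols-above : ∑ S (above ∘ proj₁) + ∑ S (above ∘ proj₂) ≡ ∑ S (λ _ → 1)
      rows-above+cols-above = begin
        ∑ S (above ∘ proj₁) + ∑ S (above ∘ proj₂)
          ≡⟨ cong (∑ S (above ∘ proj₁) +_) (sym (∑-sharp (above ∘ proj₂))) ⟩
        ∑ S (above ∘ proj₁) + ∑ S (λ α → above (star d (proj₁ α)))
          ≡⟨ sym (∑-+ S _ _) ⟩
        ∑ S (λ α → above (proj₁ α) + above (star d (proj₁ α)))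
          ≡⟨ ∑-cong {xs = S} (λ {α} _ → above-or-star-above d (proj₁ α)) ⟩
        ∑ S (λ _ → 1) ∎
        where open ≡-Reasoning

      pastDiagonal+numDiag : ∑ S pastDiagonal + ∑ S pastDiagonal + numDiag d S ≡ ∑ S (λ _ → 1)
      pastDiagonal+numDiag = begin
        ∑ S pastDiagonal + ∑ S pastDiagonal + numDiag d S
          ≡⟨ cong₂ _+_ (cong (∑ S pastDiagonal +_) (sym (∑-sharp pastDiagonal))) (length-filter≡∑ _ S) ⟩
        ∑ S pastDiagonal + ∑ S (pastDiagonal ∘ sharp d) + ∑ S onDiagonal
          ≡⟨ cong (_+ ∑ S onDiagonal) (sym (∑-+ S _ _)) ⟩
        ∑ S (λ α → pastDiagonal α + pastDiagonal (sharp d α)) + ∑ S onDiagonal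
          ≡⟨ sym (∑-+ S _ _) ⟩
        ∑ S (λ α → pastDiagonal α + pastDiagonal (sharp d α) + onDiagonal α)
          ≡⟨ ∑-cong {xs = S} trichotomy ⟩
        ∑ S (λ _ → 1) ∎
        where
        open ≡-Reasoning
        trichotomy : ∀ {α} → α ∈ S → pastDiagonal α + pastDiagonal (sharp d α) + onDiagonal α ≡ 1
        trichotomy {r , c} rc∈S = trans
          (cong (λ r** → indicator (star d c <? r) + indicator (r** <? star d c) + indicator (r ≟ star d c))
                (star-involutive d (proj₁ (S-inRange rc∈S))))
          (<-trichotomy-indicator (star d c) r)

      counting-identity : numAbove d w + (∑ S (above ∘ proj₂) + ∑ S (above ∘ proj₂))
                        ≡ numAbove d v + (∑ S pastDiagonal + ∑ S pastDiagonal) + numDiag d S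
      counting-identity = begin
        numAbove d w + (∑ S (above ∘ proj₂) + ∑ S (above ∘ proj₂))
          ≡⟨ sym (+-assoc (numAbove d w) _ _) ⟩
        numAbove d w + ∑ S (above ∘ proj₂) + ∑ S (above ∘ proj₂)
          ≡⟨ cong (_+ ∑ S (above ∘ proj₂)) numAbove-exchange ⟩
        numAbove d v + ∑ S (above ∘ proj₁) + ∑ S (above ∘ proj₂)
          ≡⟨ +-assoc (numAbove d v) _ _ ⟩
        numAbove d v + (∑ S (above ∘ proj₁) + ∑ S (above ∘ proj₂))
          ≡⟨ cong (numAbove d v +_) (trans rows-above+cols-above (sym pastDiagonal+numDiag)) ⟩
        numAbove d v + (∑ S pastDiagonal + ∑ S pastDiagonal + numDiag d S)
          ≡⟨ sym (+-assoc (numAbove d v) _ _) ⟩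
        numAbove d v + (∑ S pastDiagonal + ∑ S pastDiagonal) + numDiag d S ∎
        where open ≡-Reasoning

    even-numAbove⇔even-numDiag : 2 ∣ numAbove d w ⇔ 2 ∣ numDiag d S
    even-numAbove⇔even-numDiag =
      parity-transfer {x = ∑ S (above ∘ proj₂)} {y = ∑ S pastDiagonal} counting-identity (proj₂ (proj₂ v∈Id))

proposition5p1 : (d : ℕ) (v w : List ℕ) (S : List Pair)
    → IsId d v → IsI2d d w → v ≼ w
    → Distinguished d v S → Corresponds v S w
    → (IsId d w ⇔ (SymmetricSet d S × 2 ∣ numDiag d S))
proposition5p1 d v w S v∈Id w∈I2d _ dist cor = mk⇔
  (λ w∈Id →
    let S-symmetric = starSwaps⇒symmetric d S-inRange S-nonCrossing
                        (w-oneOfEachPair⇒starSwaps (proj₁ (proj₂ w∈Id)))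
    in S-symmetric , Equivalence.to (even-numAbove⇔even-numDiag S-symmetric) (proj₂ (proj₂ w∈Id)))
  (λ (S-symmetric , even-numDiag) →
      w∈I2d
    , starSwaps⇒w-oneOfEachPair (symmetric⇒starSwaps d S-symmetric)
    , Equivalence.from (even-numAbove⇔even-numDiag S-symmetric) even-numDiag)
  where open Correspondence v∈Id w∈I2d dist cor
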